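{- Let $n$ be an even positive integer. Then the Möbius ladder graph $L_n$ is not an open XOR-magic graph.
   Context: For an even positive integer $n$, the Möbius ladder graph is the circulant graph $L_n=C_n(\{1,\frac n2\})$: vertices $x_0,\ldots,x_{n-1}$, with distinct $x_i,x_j$ adjacent iff $|i-j|\in\{1,\,n-1,\,\frac n2\}$. For a vertex $x$, $N(x)$ is its set of neighbours. A simple connected graph $G=(V,E)$ is an open XOR-magic graph if $|V|=2^p$ for some positive integer $p$ and there is a bijection $\ell:V\to(\mathbb{Z}_2)^p$ with $\sum_{y\in N(x)}\ell(y)=0$ in $(\mathbb{Z}_2)^p$ for every $x\in V$. -}

module Defs where

open import Data.Nat using (ℕ; zero; suc; _+_; _*_; _^_; _∸_; _≤_; _<_; _≟_; _/_)
open import Data.Bool using (Bool; false; true; _xor_; if_then_else_)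
open import Data.Fin using (Fin; toℕ)
open import Data.Fin.Properties using () renaming (_≟_ to _≟ᶠ_)
open import Data.Nat.Properties using () renaming (_≟_ to _≟ℕ_)
open import Data.Product using (_,_; proj₁)
open import Data.Sum using (inj₁; inj₂)
open import Relation.Nullary.Decidable using (_×-dec_; _⊎-dec_; ¬?)
open import Relation.Binary.PropositionalEquality using (sym)
open import Data.Nat.Properties using (+-comm)
open import Data.List using (List; foldr; filterᵇ)
open import Data.List.Base using (allFin)
open import Data.Vec using (Vec; replicate; zipWith)
open import Data.Product using (Σ; _×_; ∃; ∃-syntax)
open import Data.Sum using (_⊎_)
open import Relation.Nullary using (¬_; Dec; does)
open import Relation.Binary.PropositionalEquality using (_≡_)
open import Relation.Binary.Construct.Closure.ReflexiveTransitive using (Star)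
open import Function.Bundles using (Bijection)
open import Function.Bundles using (_⤖_)

record SimpleGraph (N : ℕ) : Set₁ where
  field
    Adj       : Fin N → Fin N → Set
    adj?      : (x y : Fin N) → Dec (Adj x y)
    symmetric : ∀ {x y} → Adj x y → Adj y x
    loopless  : ∀ x → ¬ Adj x x

open SimpleGraph public

Connected : ∀ {N} → SimpleGraph N → Set
Connected {N} G = (x y : Fin N) → Star (Adj G) x y

Z2^ : ℕ → Set
Z2^ p = Vec Bool p

zeroV : ∀ {p} → Z2^ p
zeroV = replicate _ false

_⊕_ : ∀ {p} → Z2^ p → Z2^ p → Z2^ p
_⊕_ = zipWith _xor_

neighbours : ∀ {N} → SimpleGraph N → Fin N → List (Fin N)
neighbours G x = filterᵇ (λ y → does (adj? G x y)) (allFin _)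

nbSum : ∀ {N p} → SimpleGraph N → (Fin N → Z2^ p) → Fin N → Z2^ p
nbSum G ℓ x = foldr (λ y acc → ℓ y ⊕ acc) zeroV (neighbours G x)

IsOpenXORMagic : ∀ {N} → SimpleGraph N → Set
IsOpenXORMagic {N} G =
  Connected G ×
  Σ ℕ λ p → (1 ≤ p) × (N ≡ 2 ^ p) ×
    Σ (Fin N ⤖ Z2^ p) λ ℓ → (x : Fin N) → nbSum G (Bijection.to ℓ) x ≡ zeroV

∣_-_∣ : ℕ → ℕ → ℕ
∣ i - j ∣ = (i ∸ j) + (j ∸ i)

-- Möbius ladder L_n = C_n({1, n/2}): distinct x_i, x_j adjacent iff |i-j| ∈ {1, n-1, n/2}.
MobiusAdj : (n : ℕ) → Fin n → Fin n → Set
MobiusAdj n i j =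
  ¬ (i ≡ j) ×
  ((∣ toℕ i - toℕ j ∣ ≡ 1) ⊎ (∣ toℕ i - toℕ j ∣ ≡ n ∸ 1) ⊎ (∣ toℕ i - toℕ j ∣ ≡ n / 2))

∣-∣-sym : ∀ i j → ∣ i - j ∣ ≡ ∣ j - i ∣
∣-∣-sym i j = +-comm (i ∸ j) (j ∸ i)

mobiusAdj? : (n : ℕ) → (i j : Fin n) → Dec (MobiusAdj n i j)
mobiusAdj? n i j =
  ¬? (i ≟ᶠ j) ×-dec
  ((∣ toℕ i - toℕ j ∣ ≟ℕ 1) ⊎-dec (∣ toℕ i - toℕ j ∣ ≟ℕ n ∸ 1) ⊎-dec (∣ toℕ i - toℕ j ∣ ≟ℕ n / 2))

mobiusSym : (n : ℕ) → ∀ {i j} → MobiusAdj n i j → MobiusAdj n j i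
mobiusSym n {i} {j} (ne , d) = (λ e → ne (sym e)) , fix d
  where
  open Relation.Binary.PropositionalEquality using (trans)
  s = ∣-∣-sym (toℕ j) (toℕ i)
  fix : _ → _
  fix (inj₁ e) = inj₁ (trans s e)
  fix (inj₂ (inj₁ e)) = inj₂ (inj₁ (trans s e))
  fix (inj₂ (inj₂ e)) = inj₂ (inj₂ (trans s e))

MobiusLadder : (n : ℕ) → SimpleGraph n
MobiusLadder n = record
  { Adj = MobiusAdj n
  ; adj? = mobiusAdj? n
  ; symmetric = mobiusSym n
  ; loopless = λ x a → proj₁ a Relation.Binary.PropositionalEquality.refl
  }

{-# OPTIONS --safe #-}
module Submission where

-- Write f i = ℓ (x_(i mod n)) and K = n / 2. The neighbours of x_(j+1) are x_j, x_(j+2) and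
-- x_(j+1+K), so the zero-sum condition there reads f (j+2) = f (j+1+K) + f j in (ℤ₂)^p.
-- Combining it with the same condition shifted by K shows that the rung sums
-- r j = f (j+K) + f j satisfy r (j+2) = r (j+1) + r j, hence r has period 3 as well as
-- period K. A power of 2 is coprime to 3, so r is constant, and r = r + r forces r = 0,
-- i.e. f K = f 0, contradicting injectivity of ℓ. For n = 2 the two vertices are each
-- other's only neighbour, so both labels are 0.

open import Defs
open import Level using (0ℓ)
open import Algebra.Bundles using (AbelianGroup)
open import Algebra.Structures using (IsAbelianGroup; IsCommutativeMonoid)
import Algebra.Properties.AbelianGroup as AbelianGroupProperties
import Algebra.Properties.CommutativeSemigroup as CommutativeSemigroupProperties
open import Data.Bool using (T)
open import Data.Bool.Properties using (xor-assoc; xor-comm; xor-identityˡ; xor-identityʳ; xor-same)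
open import Data.Fin using (Fin; toℕ; zero; suc)
open import Data.Fin.Properties using (toℕ-fromℕ<; toℕ-injective; toℕ<n; 0≢1+n)
open import Data.List using (List; []; _∷_; foldr; map; allFin)
open import Data.List.Membership.Propositional using (_∈_)
open import Data.List.Membership.Propositional.Properties using (∈-filter⁺; ∈-filter⁻; ∈-allFin)
open import Data.List.Membership.Propositional.Properties.WithK using (unique∧set⇒bag)
open import Data.List.Properties using (foldr-map)
open import Data.List.Relation.Binary.BagAndSetEquality using (∼bag⇒↭)
open import Data.List.Relation.Binary.Permutation.Propositional using (_↭_; ↭⇒↭ₛ)
open import Data.List.Relation.Binary.Permutation.Propositional.Properties using (map⁺)
open import Data.List.Relation.Binary.Permutation.Setoid.Properties using (foldr-commMonoid)
open import Data.List.Relation.Unary.All using ([]; _∷_)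
open import Data.List.Relation.Unary.AllPairs using ([]; _∷_)
open import Data.List.Relation.Unary.Any using (here; there)
open import Data.List.Relation.Unary.Unique.Propositional using (Unique)
open import Data.List.Relation.Unary.Unique.Propositional.Properties using (filter⁺; allFin⁺)
open import Data.Nat using (ℕ; zero; suc; pred; _+_; _*_; _∸_; _^_; _≤_; _<_; _<?_; _/_; _%_; NonZero; s≤s; z≤n)
open import Data.Nat.Coprimality using (Coprime; coprime-Bézout)
open import Data.Nat.Divisibility using (_∣_; ∣1⇒≡1; ∣⇒≤)
open import Data.Nat.DivMod using (_mod_; %-distribˡ-+; m<n⇒m%n≡m; [m+n]%n≡m%n; [m+kn]%n≡m%n; m%n%n≡m%n; m*n/n≡m)
open import Data.Nat.GCD using (module Bézout)
open import Data.Nat.Primality using (Prime; prime?; prime⇒irreducible; euclidsLemma)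
open import Data.Nat.Properties
  using ( +-assoc; +-comm; +-suc; +-identityʳ; +-commutativeSemigroup; *-comm; *-suc
        ; ≤-total; ≤-<-trans; ≮⇒≥; +-cancelˡ-≤; m≤m+n; m<m+n; n<1+n; suc-injective; suc-pred
        ; m≤n⇒m∸n≡0; m+[n∸m]≡n; m+n∸m≡n; m∸n+n≡m; m∸n≤m; n∸n≡0; m+1+n≢0; m+1+n≢m
        ; *-cancelˡ-≡; *-monoʳ-≤; m^n>0)
open import Data.Product using (∃; _,_; proj₂)
open import Data.Sum using (_⊎_; inj₁; inj₂; [_,_]′; reduce)
import Data.Sum as Sum
open import Data.Unit using (tt)
open import Data.Vec using ([]; _∷_)
open import Data.Vec.Properties using (zipWith-assoc; zipWith-comm; zipWith-identityˡ; zipWith-identityʳ)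
open import Function using (id; _∘_; case_of_)
open import Function.Bundles using (_⇔_; mk⇔; Equivalence; Bijection)
open import Function.Definitions using (Injective)
open import Relation.Binary.PropositionalEquality
  using (_≡_; _≢_; refl; sym; trans; cong; cong₂; subst; setoid; module ≡-Reasoning)
open import Relation.Binary.PropositionalEquality.Algebra using (isMagma)
open import Relation.Nullary using (¬_; Dec; yes; no; does; contradiction)
open import Relation.Nullary.Decidable using (T?; from-yes)

open Bézout.Identity using (+-; -+)

⊕-self : ∀ {p} (u : Z2^ p) → u ⊕ u ≡ zeroV
⊕-self []      = refl
⊕-self (a ∷ u) = cong₂ _∷_ (xor-same a) (⊕-self u)

⊕-isAbelianGroup : ∀ {p} → IsAbelianGroup _≡_ (_⊕_ {p}) zeroV id
⊕-isAbelianGroup = record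
  { isGroup = record
    { isMonoid = record
      { isSemigroup = record { isMagma = isMagma _⊕_ ; assoc = zipWith-assoc xor-assoc }
      ; identity    = zipWith-identityˡ xor-identityˡ , zipWith-identityʳ xor-identityʳ
      }
    ; inverse = ⊕-self , ⊕-self
    ; ⁻¹-cong = cong id
    }
  ; comm = zipWith-comm xor-comm
  }

⊕-abelianGroup : ℕ → AbelianGroup 0ℓ 0ℓ
⊕-abelianGroup p = record { isAbelianGroup = ⊕-isAbelianGroup {p} }

ZeroSumLabelling : ∀ {N p} → SimpleGraph N → (Fin N → Z2^ p) → Set
ZeroSumLabelling G ℓ = ∀ x → nbSum G ℓ x ≡ zeroV

T-does⇔ : ∀ {A : Set} (a? : Dec A) → T (does a?) ⇔ A
T-does⇔ (yes a)  = mk⇔ (λ _ → a) (λ _ → tt)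
T-does⇔ (no ¬a) = mk⇔ (λ ()) ¬a

module _ {N} (G : SimpleGraph N) where

  private
    adjacent? : (x y : Fin N) → Dec (T (does (adj? G x y)))
    adjacent? x y = T? (does (adj? G x y))

  ∈-neighbours⇔ : ∀ {x y} → y ∈ neighbours G x ⇔ Adj G x y
  ∈-neighbours⇔ {x} {y} = mk⇔
    (λ y∈ → Equivalence.to (T-does⇔ (adj? G x y)) (proj₂ (∈-filter⁻ (adjacent? x) {xs = allFin N} y∈)))
    (λ adj → ∈-filter⁺ (adjacent? x) (∈-allFin y) (Equivalence.from (T-does⇔ (adj? G x y)) adj))

  nbSum-enumeration : ∀ {p} (ℓ : Fin N → Z2^ p) {x ys} → Unique ys → (∀ {y} → y ∈ ys ⇔ Adj G x y) →
                      nbSum G ℓ x ≡ foldr (λ y s → ℓ y ⊕ s) zeroV ys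
  nbSum-enumeration {p} ℓ {x} {ys} ys! ys⇔ = begin
    foldr (λ y s → ℓ y ⊕ s) zeroV (neighbours G x)  ≡⟨ foldr-map _⊕_ ℓ zeroV (neighbours G x) ⟨
    foldr _⊕_ zeroV (map ℓ (neighbours G x))        ≡⟨ foldr-commMonoid (setoid _) ⊕-isCommutativeMonoid
                                                          (↭⇒↭ₛ (map⁺ ℓ neighbours↭ys)) ⟩
    foldr _⊕_ zeroV (map ℓ ys)                      ≡⟨ foldr-map _⊕_ ℓ zeroV ys ⟩
    foldr (λ y s → ℓ y ⊕ s) zeroV ys                ∎
    where
    open ≡-Reasoning
    ⊕-isCommutativeMonoid : IsCommutativeMonoid _≡_ (_⊕_ {p}) zeroV
    ⊕-isCommutativeMonoid = IsAbelianGroup.isCommutativeMonoid ⊕-isAbelianGroup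
    neighbours↭ys : neighbours G x ↭ ys
    neighbours↭ys = ∼bag⇒↭ (unique∧set⇒bag (filter⁺ (adjacent? x) (allFin⁺ N)) ys!
      (mk⇔ (Equivalence.from ys⇔ ∘ Equivalence.to ∈-neighbours⇔)
           (Equivalence.from ∈-neighbours⇔ ∘ Equivalence.to ys⇔)))

Period : {A : Set} → ℕ → (ℕ → A) → Set
Period p f = ∀ j → f (p + j) ≡ f j

module _ {A : Set} {f : ℕ → A} where
  open ≡-Reasoning

  period-* : ∀ {p} → Period p f → ∀ t → Period (t * p) f
  period-*     per zero    j = refl
  period-* {p} per (suc t) j = begin
    f (p + t * p + j)   ≡⟨ cong f (+-assoc p (t * p) j) ⟩
    f (p + (t * p + j)) ≡⟨ per (t * p + j) ⟩
    f (t * p + j)       ≡⟨ period-* per t j ⟩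
    f j                 ∎

  Bézout⇒period-1 : ∀ {p q} s t → 1 + t * q ≡ s * p → Period p f → Period q f → Period 1 f
  Bézout⇒period-1 {p} {q} s t eq per-p per-q j = begin
    f (1 + j)           ≡⟨ period-* per-q t (1 + j) ⟨
    f (t * q + (1 + j)) ≡⟨ cong f (+-suc (t * q) j) ⟩
    f (1 + t * q + j)   ≡⟨ cong (λ n → f (n + j)) eq ⟩
    f (s * p + j)       ≡⟨ period-* per-p s j ⟩
    f j                 ∎

  coprime-periods⇒period-1 : ∀ {p q} → Coprime p q → Period p f → Period q f → Period 1 f
  coprime-periods⇒period-1 p⊥q per-p per-q with coprime-Bézout p⊥q
  ... | +- x y eq = Bézout⇒period-1 x y eq per-p per-q
  ... | -+ x y eq = Bézout⇒period-1 y x eq per-q per-p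

  period-1⇒constant : Period 1 f → ∀ j → f j ≡ f 0
  period-1⇒constant per zero    = refl
  period-1⇒constant per (suc j) = trans (per j) (period-1⇒constant per j)

prime[3] : Prime 3
prime[3] = from-yes (prime? 3)

3∤2^ : ∀ n → ¬ 3 ∣ 2 ^ n
3∤2^ zero    3∣1       = case ∣1⇒≡1 3∣1 of λ ()
3∤2^ (suc n) 3∣2^[1+n] = [ 3∤2 , 3∤2^ n ]′ (euclidsLemma 2 (2 ^ n) prime[3] 3∣2^[1+n])
  where
  3∤2 : ¬ 3 ∣ 2
  3∤2 3∣2 with s≤s (s≤s ()) ← ∣⇒≤ 3∣2

coprime-3-2^ : ∀ n → Coprime 3 (2 ^ n)
coprime-3-2^ n (d∣3 , d∣2^n) with prime⇒irreducible prime[3] d∣3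
... | inj₁ d≡1 = d≡1
... | inj₂ refl = contradiction d∣2^n (3∤2^ n)

-- The ∣_-_∣ of Defs is (m ∸ n) + (n ∸ m), not the one of Data.Nat, so its basic facts are proved here.
∣-∣-split : ∀ m n → n ≡ m + ∣ m - n ∣ ⊎ m ≡ n + ∣ m - n ∣
∣-∣-split m n with ≤-total m n
... | inj₁ m≤n = inj₁ (begin
  n                        ≡⟨ m+[n∸m]≡n m≤n ⟨
  m + (n ∸ m)              ≡⟨ cong (λ z → m + (z + (n ∸ m))) (m≤n⇒m∸n≡0 m≤n) ⟨
  m + ((m ∸ n) + (n ∸ m))  ∎)
  where open ≡-Reasoning
... | inj₂ n≤m = inj₂ (begin
  m                        ≡⟨ m+[n∸m]≡n n≤m ⟨
  n + (m ∸ n)              ≡⟨ cong (n +_) (+-identityʳ (m ∸ n)) ⟨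
  n + ((m ∸ n) + 0)        ≡⟨ cong (λ z → n + ((m ∸ n) + z)) (m≤n⇒m∸n≡0 n≤m) ⟨
  n + ((m ∸ n) + (n ∸ m))  ∎)
  where open ≡-Reasoning

∣m-m+d∣≡d : ∀ m d → ∣ m - m + d ∣ ≡ d
∣m-m+d∣≡d m d = cong₂ _+_ (m≤n⇒m∸n≡0 (m≤m+n m d)) (m+n∸m≡n m d)

∣m+d-m∣≡d : ∀ m d → ∣ m + d - m ∣ ≡ d
∣m+d-m∣≡d m d = trans (∣-∣-sym (m + d) m) (∣m-m+d∣≡d m d)

∣n-n∣≡0 : ∀ n → ∣ n - n ∣ ≡ 0
∣n-n∣≡0 n = cong₂ _+_ (n∸n≡0 n) (n∸n≡0 n)

module _ {N : ℕ} .{{_ : NonZero N}} where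
  open ≡-Reasoning

  +-congʳ-% : ∀ {m n} c → m % N ≡ n % N → (m + c) % N ≡ (n + c) % N
  +-congʳ-% {m} {n} c eq = begin
    (m + c) % N           ≡⟨ %-distribˡ-+ m c N ⟩
    (m % N + c % N) % N   ≡⟨ cong (λ r → (r + c % N) % N) eq ⟩
    (n % N + c % N) % N   ≡⟨ %-distribˡ-+ n c N ⟨
    (n + c) % N           ∎

  +-congˡ-% : ∀ c {m n} → m % N ≡ n % N → (c + m) % N ≡ (c + n) % N
  +-congˡ-% c {m} {n} eq = begin
    (c + m) % N  ≡⟨ cong (_% N) (+-comm c m) ⟩
    (m + c) % N  ≡⟨ +-congʳ-% c eq ⟩
    (n + c) % N  ≡⟨ cong (_% N) (+-comm n c) ⟩
    (c + n) % N  ∎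

  +-cancelʳ-% : ∀ d e i → (d + i) % N ≡ (e + i) % N → d % N ≡ e % N
  +-cancelʳ-% d e i eq = begin
    d % N                      ≡⟨ [m+kn]%n≡m%n d i N ⟨
    (d + i * N) % N            ≡⟨ cong (_% N) (unfold d) ⟩
    (d + i + i * pred N) % N   ≡⟨ +-congʳ-% (i * pred N) eq ⟩
    (e + i + i * pred N) % N   ≡⟨ cong (_% N) (unfold e) ⟨
    (e + i * N) % N            ≡⟨ [m+kn]%n≡m%n e i N ⟩
    e % N                      ∎
    where
    unfold : ∀ a → a + i * N ≡ a + i + i * pred N
    unfold a = begin
      a + i * N                ≡⟨ cong (λ n → a + i * n) (suc-pred N) ⟨
      a + i * suc (pred N)     ≡⟨ cong (a +_) (*-suc i (pred N)) ⟩
      a + (i + i * pred N)     ≡⟨ +-assoc a i (i * pred N) ⟨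
      a + i + i * pred N       ∎

  module _ {d e : ℕ} (d+e≡N : d + e ≡ N) {x y : ℕ} (x<N : x < N) (y<N : y < N) where

    ∣-∣≡⇒≡+% : ∣ x - y ∣ ≡ d → y ≡ (d + x) % N ⊎ y ≡ (e + x) % N
    ∣-∣≡⇒≡+% D≡d with ∣-∣-split x y
    ... | inj₁ y≡x+D = inj₁ (begin
      y                    ≡⟨ m<n⇒m%n≡m y<N ⟨
      y % N                ≡⟨ cong (_% N) y≡x+D ⟩
      (x + ∣ x - y ∣) % N  ≡⟨ cong (λ D → (x + D) % N) D≡d ⟩
      (x + d) % N          ≡⟨ cong (_% N) (+-comm x d) ⟩
      (d + x) % N          ∎)
    ... | inj₂ x≡y+D = inj₂ (begin
      y                          ≡⟨ m<n⇒m%n≡m y<N ⟨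
      y % N                      ≡⟨ [m+n]%n≡m%n y N ⟨
      (y + N) % N                ≡⟨ cong (λ n → (y + n) % N) (trans (sym d+e≡N) (+-comm d e)) ⟩
      (y + (e + d)) % N          ≡⟨ cong (_% N) (x∙yz≈y∙xz y e d) ⟩
      (e + (y + d)) % N          ≡⟨ cong (λ D → (e + (y + D)) % N) D≡d ⟨
      (e + (y + ∣ x - y ∣)) % N  ≡⟨ cong (λ x → (e + x) % N) x≡y+D ⟨
      (e + x) % N                ∎)
      where open CommutativeSemigroupProperties +-commutativeSemigroup using (x∙yz≈y∙xz)

    ≡+%⇒∣-∣≡ : y ≡ (d + x) % N → ∣ x - y ∣ ≡ d ⊎ ∣ x - y ∣ ≡ e
    ≡+%⇒∣-∣≡ y≡ with d + x <? N
    ... | yes d+x<N = inj₁ (begin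
      ∣ x - y ∣      ≡⟨ cong (λ y → ∣ x - y ∣) (trans y≡ (m<n⇒m%n≡m d+x<N)) ⟩
      ∣ x - d + x ∣  ≡⟨ cong (λ z → ∣ x - z ∣) (+-comm d x) ⟩
      ∣ x - x + d ∣  ≡⟨ ∣m-m+d∣≡d x d ⟩
      d              ∎)
    ... | no d+x≮N = inj₂ (begin
      ∣ x - y ∣      ≡⟨ cong₂ ∣_-_∣ (sym t+e≡x) y≡t ⟩
      ∣ t + e - t ∣  ≡⟨ ∣m+d-m∣≡d t e ⟩
      e              ∎)
      where
      t : ℕ
      t = x ∸ e
      t+e≡x : t + e ≡ x
      t+e≡x = m∸n+n≡m (+-cancelˡ-≤ d e x (subst (_≤ d + x) (sym d+e≡N) (≮⇒≥ d+x≮N)))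
      y≡t : y ≡ t
      y≡t = begin
        y                  ≡⟨ y≡ ⟩
        (d + x) % N        ≡⟨ cong (λ x → (d + x) % N) (trans (sym t+e≡x) (+-comm t e)) ⟩
        (d + (e + t)) % N  ≡⟨ cong (_% N) (+-assoc d e t) ⟨
        (d + e + t) % N    ≡⟨ cong (λ n → (n + t) % N) d+e≡N ⟩
        (N + t) % N        ≡⟨ cong (_% N) (+-comm N t) ⟩
        (t + N) % N        ≡⟨ [m+n]%n≡m%n t N ⟩
        t % N              ≡⟨ m<n⇒m%n≡m (≤-<-trans (m∸n≤m x e) x<N) ⟩
        t                  ∎

  cyclic-distance : ∀ {d e} → d + e ≡ N → ∀ {x y} → x < N → y < N →
                    (∣ x - y ∣ ≡ d ⊎ ∣ x - y ∣ ≡ e) ⇔ (y ≡ (d + x) % N ⊎ y ≡ (e + x) % N)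
  cyclic-distance {d} {e} d+e≡N x<N y<N = mk⇔
    [ ∣-∣≡⇒≡+% d+e≡N x<N y<N , Sum.swap ∘ ∣-∣≡⇒≡+% e+d≡N x<N y<N ]′
    [ ≡+%⇒∣-∣≡ d+e≡N x<N y<N , Sum.swap ∘ ≡+%⇒∣-∣≡ e+d≡N x<N y<N ]′
    where e+d≡N = trans (+-comm e d) d+e≡N

  toℕ-mod : ∀ m → toℕ (m mod N) ≡ m % N
  toℕ-mod m = toℕ-fromℕ< _

  mod-cong : ∀ m n → m % N ≡ n % N → m mod N ≡ n mod N
  mod-cong m n eq = toℕ-injective (trans (toℕ-mod m) (trans eq (sym (toℕ-mod n))))

  toℕ≡%⇒≡mod : ∀ {y : Fin N} m → toℕ y ≡ m % N → y ≡ m mod N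
  toℕ≡%⇒≡mod m eq = toℕ-injective (trans eq (sym (toℕ-mod m)))

  ≡mod⇒toℕ≡% : ∀ {y : Fin N} m → y ≡ m mod N → toℕ y ≡ m % N
  ≡mod⇒toℕ≡% m eq = trans (cong toℕ eq) (toℕ-mod m)

  +-mod-injective : ∀ {d e} i → d < N → e < N → (d + i) mod N ≡ (e + i) mod N → d ≡ e
  +-mod-injective {d} {e} i d<N e<N eq = begin
    d      ≡⟨ m<n⇒m%n≡m d<N ⟨
    d % N  ≡⟨ +-cancelʳ-% d e i (trans (sym (toℕ-mod (d + i))) (trans (cong toℕ eq) (toℕ-mod (e + i)))) ⟩
    e % N  ≡⟨ m<n⇒m%n≡m e<N ⟩
    e      ∎

module LadderRecurrence {p} (K : ℕ) {f : ℕ → Z2^ p} (per : Period (2 * K) f)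
                        (rec : ∀ j → f (2 + j) ≡ f (K + suc j) ⊕ f j) where
  open ≡-Reasoning
  open AbelianGroup (⊕-abelianGroup p) using (comm; commutativeSemigroup)
  open AbelianGroupProperties (⊕-abelianGroup p) using (inverseˡ-unique; xyx⁻¹≈y)
  open CommutativeSemigroupProperties commutativeSemigroup using (interchange)

  rungSum : ℕ → Z2^ p
  rungSum j = f (K + j) ⊕ f j

  f-K+K : ∀ j → f (K + (K + j)) ≡ f j
  f-K+K j = trans (cong f (trans (sym (+-assoc K K j)) (cong (λ n → K + n + j) (sym (+-identityʳ K))))) (per j)

  rungSum-period-K : Period K rungSum
  rungSum-period-K j = trans (cong (_⊕ f (K + j)) (f-K+K j)) (comm (f j) (f (K + j)))

  rungSum-rec : ∀ j → rungSum (2 + j) ≡ rungSum (1 + j) ⊕ rungSum j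
  rungSum-rec j = begin
    f (K + (2 + j)) ⊕ f (2 + j)
      ≡⟨ cong₂ _⊕_ (trans (cong f K+[2+j]≡2+[K+j]) (rec (K + j))) (rec j) ⟩
    (f (K + suc (K + j)) ⊕ f (K + j)) ⊕ (f (K + suc j) ⊕ f j)
      ≡⟨ cong (λ z → (z ⊕ f (K + j)) ⊕ (f (K + suc j) ⊕ f j)) f-K+suc[K+j] ⟩
    (f (suc j) ⊕ f (K + j)) ⊕ (f (K + suc j) ⊕ f j)
      ≡⟨ interchange (f (suc j)) (f (K + j)) (f (K + suc j)) (f j) ⟩
    (f (suc j) ⊕ f (K + suc j)) ⊕ (f (K + j) ⊕ f j)
      ≡⟨ cong (_⊕ rungSum j) (comm (f (suc j)) (f (K + suc j))) ⟩
    rungSum (1 + j) ⊕ rungSum j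
      ∎
    where
    K+[2+j]≡2+[K+j] : K + (2 + j) ≡ 2 + (K + j)
    K+[2+j]≡2+[K+j] = trans (+-suc K (suc j)) (cong suc (+-suc K j))
    f-K+suc[K+j] : f (K + suc (K + j)) ≡ f (suc j)
    f-K+suc[K+j] = trans (cong (λ n → f (K + n)) (sym (+-suc K j))) (f-K+K (suc j))

  rungSum-period-3 : Period 3 rungSum
  rungSum-period-3 j = begin
    rungSum (3 + j)                                  ≡⟨ rungSum-rec (1 + j) ⟩
    rungSum (2 + j) ⊕ rungSum (1 + j)                ≡⟨ cong (_⊕ rungSum (1 + j)) (rungSum-rec j) ⟩
    (rungSum (1 + j) ⊕ rungSum j) ⊕ rungSum (1 + j)  ≡⟨ xyx⁻¹≈y (rungSum (1 + j)) (rungSum j) ⟩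
    rungSum j                                        ∎

  module _ (3⊥K : Coprime 3 K) where

    rungSum-constant : ∀ j → rungSum j ≡ rungSum 0
    rungSum-constant = period-1⇒constant (coprime-periods⇒period-1 3⊥K rungSum-period-3 rungSum-period-K)

    rungSum≡zero : ∀ j → rungSum j ≡ zeroV
    rungSum≡zero j = begin
      rungSum j              ≡⟨ rungSum-constant j ⟩
      rungSum 0              ≡⟨ rungSum-constant 2 ⟨
      rungSum 2              ≡⟨ rungSum-rec 0 ⟩
      rungSum 1 ⊕ rungSum 0  ≡⟨ cong (_⊕ rungSum 0) (rungSum-constant 1) ⟩
      rungSum 0 ⊕ rungSum 0  ≡⟨ ⊕-self (rungSum 0) ⟩
      zeroV                  ∎

    half-period : Period K f
    half-period j = inverseˡ-unique (f (K + j)) (f j) (rungSum≡zero j)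

module MobiusLadderLabelling (k : ℕ) where
  open ≡-Reasoning

  K N : ℕ
  K = 2 + k
  N = 2 * K

  G : SimpleGraph N
  G = MobiusLadder N

  N/2≡K : N / 2 ≡ K
  N/2≡K = trans (cong (_/ 2) (*-comm 2 K)) (m*n/n≡m K 2)

  K+K≡N : K + K ≡ N
  K+K≡N = cong (K +_) (sym (+-identityʳ K))

  1<N : 1 < N
  1<N = s≤s (s≤s z≤n)

  K<N : K < N
  K<N = m<m+n K (s≤s z≤n)

  N∸1<N : N ∸ 1 < N
  N∸1<N = n<1+n (N ∸ 1)

  neighbourhood : Fin N → List (Fin N)
  neighbourhood x = (1 + toℕ x) mod N ∷ (K + toℕ x) mod N ∷ (N ∸ 1 + toℕ x) mod N ∷ []

  ∣-∣≡suc⇒≢ : ∀ {x y : Fin N} {m} → ∣ toℕ x - toℕ y ∣ ≡ suc m → x ≢ y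
  ∣-∣≡suc⇒≢ {x} eq refl with () ← trans (sym (∣n-n∣≡0 (toℕ x))) eq

  ∈-neighbourhood⇔ : ∀ {x y} → y ∈ neighbourhood x ⇔ Adj G x y
  ∈-neighbourhood⇔ {x} {y} = mk⇔ from to
    where
    D : ℕ
    D = ∣ toℕ x - toℕ y ∣
    open Equivalence (cyclic-distance {N} {1} {N ∸ 1} refl (toℕ<n x) (toℕ<n y))
      renaming (to to short-to; from to short-from)
    open Equivalence (cyclic-distance {N} {K} {K} K+K≡N (toℕ<n x) (toℕ<n y))
      renaming (to to half-to; from to half-from)

    short-adj : D ≡ 1 ⊎ D ≡ N ∸ 1 → Adj G x y
    short-adj (inj₁ D≡1)   = ∣-∣≡suc⇒≢ D≡1 , inj₁ D≡1
    short-adj (inj₂ D≡N∸1) = ∣-∣≡suc⇒≢ D≡N∸1 , inj₂ (inj₁ D≡N∸1)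

    half-adj : D ≡ K → Adj G x y
    half-adj D≡K = ∣-∣≡suc⇒≢ D≡K , inj₂ (inj₂ (trans D≡K (sym N/2≡K)))

    short-∈ : toℕ y ≡ (1 + toℕ x) % N ⊎ toℕ y ≡ (N ∸ 1 + toℕ x) % N → y ∈ neighbourhood x
    short-∈ (inj₁ eq) = here (toℕ≡%⇒≡mod (1 + toℕ x) eq)
    short-∈ (inj₂ eq) = there (there (here (toℕ≡%⇒≡mod (N ∸ 1 + toℕ x) eq)))

    from : y ∈ neighbourhood x → Adj G x y
    from (here eq)                 = short-adj (short-from (inj₁ (≡mod⇒toℕ≡% (1 + toℕ x) eq)))
    from (there (here eq))         = half-adj (reduce (half-from (inj₁ (≡mod⇒toℕ≡% (K + toℕ x) eq))))
    from (there (there (here eq))) = short-adj (short-from (inj₂ (≡mod⇒toℕ≡% (N ∸ 1 + toℕ x) eq)))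

    to : Adj G x y → y ∈ neighbourhood x
    to (_ , inj₁ D≡1)          = short-∈ (short-to (inj₁ D≡1))
    to (_ , inj₂ (inj₁ D≡N∸1)) = short-∈ (short-to (inj₂ D≡N∸1))
    to (_ , inj₂ (inj₂ D≡N/2)) =
      there (here (toℕ≡%⇒≡mod (K + toℕ x) (reduce (half-to (inj₁ (trans D≡N/2 N/2≡K))))))

  neighbourhood-unique : ∀ x → Unique (neighbourhood x)
  neighbourhood-unique x = (1≢K ∷ 1≢N∸1 ∷ []) ∷ (K≢N∸1 ∷ []) ∷ [] ∷ []
    where
    i : ℕ
    i = toℕ x
    1≢K : (1 + i) mod N ≢ (K + i) mod N
    1≢K eq with () ← +-mod-injective i 1<N K<N eq
    1≢N∸1 : (1 + i) mod N ≢ (N ∸ 1 + i) mod N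
    1≢N∸1 eq = m+1+n≢0 k (sym (suc-injective (+-mod-injective i 1<N N∸1<N eq)))
    K≢N∸1 : (K + i) mod N ≢ (N ∸ 1 + i) mod N
    K≢N∸1 eq = m+1+n≢m k (sym (suc-injective (trans (suc-injective K≡N∸1) (+-suc k _))))
      where
      K≡N∸1 : K ≡ N ∸ 1
      K≡N∸1 = +-mod-injective i K<N N∸1<N eq

  nbSum-MobiusLadder : ∀ {p} (ℓ : Fin N → Z2^ p) i →
    nbSum G ℓ (i mod N) ≡ ℓ ((1 + i) mod N) ⊕ (ℓ ((K + i) mod N) ⊕ ℓ ((N ∸ 1 + i) mod N))
  nbSum-MobiusLadder {p} ℓ i = begin
    nbSum G ℓ (i mod N)
      ≡⟨ nbSum-enumeration G ℓ (neighbourhood-unique (i mod N)) ∈-neighbourhood⇔ ⟩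
    ℓ ((1 + x) mod N) ⊕ (ℓ ((K + x) mod N) ⊕ (ℓ ((N ∸ 1 + x) mod N) ⊕ zeroV))
      ≡⟨ cong (λ z → ℓ ((1 + x) mod N) ⊕ (ℓ ((K + x) mod N) ⊕ z)) (identityʳ _) ⟩
    ℓ ((1 + x) mod N) ⊕ (ℓ ((K + x) mod N) ⊕ ℓ ((N ∸ 1 + x) mod N))
      ≡⟨ cong₂ _⊕_ (cong ℓ (offset 1)) (cong₂ _⊕_ (cong ℓ (offset K)) (cong ℓ (offset (N ∸ 1)))) ⟩
    ℓ ((1 + i) mod N) ⊕ (ℓ ((K + i) mod N) ⊕ ℓ ((N ∸ 1 + i) mod N))
      ∎
    where
    open AbelianGroup (⊕-abelianGroup p) using (identityʳ)
    x : ℕ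
    x = toℕ (i mod N)
    offset : ∀ d → (d + x) mod N ≡ (d + i) mod N
    offset d = mod-cong (d + x) (d + i) (+-congˡ-% d {x} {i} (trans (cong (_% N) (toℕ-mod i)) (m%n%n≡m%n i N)))

  module _ {p} {ℓ : Fin N → Z2^ p} (zero-sums : ZeroSumLabelling G ℓ) where
    open AbelianGroupProperties (⊕-abelianGroup p) using (inverseˡ-unique)

    f : ℕ → Z2^ p
    f i = ℓ (i mod N)

    f-period : Period N f
    f-period j = cong ℓ (mod-cong (N + j) j (trans (cong (_% N) (+-comm N j)) ([m+n]%n≡m%n j N)))

    f-rec : ∀ j → f (2 + j) ≡ f (K + suc j) ⊕ f j
    f-rec j = begin
      f (2 + j)                          ≡⟨ inverseˡ-unique _ _ zero-sum-at-1+j ⟩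
      f (K + suc j) ⊕ f (N ∸ 1 + suc j)  ≡⟨ cong (f (K + suc j) ⊕_) f-N∸1+suc-j ⟩
      f (K + suc j) ⊕ f j                ∎
      where
      zero-sum-at-1+j : f (2 + j) ⊕ (f (K + suc j) ⊕ f (N ∸ 1 + suc j)) ≡ zeroV
      zero-sum-at-1+j = trans (sym (nbSum-MobiusLadder ℓ (suc j))) (zero-sums (suc j mod N))
      f-N∸1+suc-j : f (N ∸ 1 + suc j) ≡ f j
      f-N∸1+suc-j = trans (cong f (+-suc (N ∸ 1) j)) (f-period j)

    not-injective : Coprime 3 K → ¬ Injective _≡_ _≡_ ℓ
    not-injective 3⊥K ℓ-injective = case +-mod-injective 0 K<N (s≤s z≤n) xK≡x0 of λ ()
      where
      xK≡x0 : (K + 0) mod N ≡ (0 + 0) mod N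
      xK≡x0 = ℓ-injective (LadderRecurrence.half-period K f-period f-rec 3⊥K 0)

MobiusLadder-no-injective-zero-sum : ∀ {K p} {ℓ : Fin (2 * K) → Z2^ p} → 2 ≤ K → Coprime 3 K →
  ZeroSumLabelling (MobiusLadder (2 * K)) ℓ → ¬ Injective _≡_ _≡_ ℓ
MobiusLadder-no-injective-zero-sum {suc (suc k)} (s≤s (s≤s z≤n)) 3⊥K zero-sums =
  MobiusLadderLabelling.not-injective k zero-sums 3⊥K

MobiusLadder₂-no-injective-zero-sum : ∀ {p} {ℓ : Fin 2 → Z2^ p} →
  ZeroSumLabelling (MobiusLadder 2) ℓ → ¬ Injective _≡_ _≡_ ℓ
MobiusLadder₂-no-injective-zero-sum {p} {ℓ} zero-sums ℓ-injective = 0≢1+n (ℓ-injective ℓ₀≡ℓ₁)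
  where
  open ≡-Reasoning
  open AbelianGroup (⊕-abelianGroup p) using (identityʳ)
  -- The neighbour sums of L₂ reduce by evaluation.
  ℓ₀≡ℓ₁ : ℓ zero ≡ ℓ (suc zero)
  ℓ₀≡ℓ₁ = begin
    ℓ zero                ≡⟨ identityʳ _ ⟨
    ℓ zero ⊕ zeroV        ≡⟨ zero-sums (suc zero) ⟩
    zeroV                 ≡⟨ zero-sums zero ⟨
    ℓ (suc zero) ⊕ zeroV  ≡⟨ identityʳ _ ⟩
    ℓ (suc zero)          ∎

corollary7 : (n : ℕ) → 1 ≤ n → ∃ (λ k → n ≡ 2 * k) → ¬ IsOpenXORMagic (MobiusLadder n)
corollary7 .(2 * k) _ (k , refl) (_ , suc q , _ , 2k≡2^[1+q] , ℓ , zero-sums)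
  with refl ← *-cancelˡ-≡ k (2 ^ q) 2 2k≡2^[1+q] | q
... | zero   = MobiusLadder₂-no-injective-zero-sum zero-sums (Bijection.injective ℓ)
... | suc q′ = MobiusLadder-no-injective-zero-sum (*-monoʳ-≤ 2 (m^n>0 2 q′)) (coprime-3-2^ (suc q′))
                 zero-sums (Bijection.injective ℓ)
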